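{- Let $n \ge 1$ and let $i$ be an integer with $(3^n+1)/2 \le i \le (5 \cdot 3^n - 3)/6$. Write $$i = \frac{3^n+1}{2} + i_0 + i_1 \cdot 3 + i_2 \cdot 3^2 + \cdots + i_{n-2} \cdot 3^{n-2}$$ with digits $i_t \in \{0,1,2\}$ for $0 \le t \le n-2$. This is possible since $(5\cdot 3^n - 3)/6 - (3^n+1)/2 = 2 + 2\cdot 3 + \cdots + 2 \cdot 3^{n-2}$. Then the following statements are equivalent: (i) $\binom{3i - \frac{3^n-1}{2}}{i - \frac{3^n+1}{2}} \not\equiv 0 \pmod 3$; (ii) $2 \ge i_0 \ge i_1 \ge \cdots \ge i_{n-2} \ge 0$; (iii) $i = \frac{3^n+1}{2} + \frac{3^j - 1}{2} + \frac{3^k - 1}{2}$ for some integers $0 \le j \le k \le n-1$. -}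

module Defs where

open import Data.Nat using (ℕ; _+_; _*_; _^_)
open import Data.Fin using (Fin; toℕ)
open import Data.Vec using (sum; tabulate)

base3 : (k : ℕ) → (Fin k → ℕ) → ℕ
base3 k d = sum (tabulate (λ t → d t * 3 ^ toℕ t))

{-# OPTIONS --safe #-}
module Submission where

-- With x = i − (3ⁿ+1)/2 = Σ dₜ 3ᵗ, the binomial coefficient is C(2 + 3(x + 3ⁿ⁻¹), x). Its top
-- has base-3 digits 2, d₀, …, d_{n−2}, 1 and its bottom d₀, …, d_{n−2}, so by Lucas' theorem
-- it is congruent to C(2,d₀) C(d₀,d₁) ⋯ C(d_{n−3},d_{n−2}) mod 3, which is nonzero exactly when
-- the digits descend. A descending string of digits ≤ 2 is the sum of the digit strings
-- 1…1 0…0 (j ones) and 1…1 0…0 (k ones) with j ≤ k, i.e. x = (3ʲ−1)/2 + (3ᵏ−1)/2; uniqueness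
-- of base-3 digits gives the converse.

open import Defs
open import Data.Nat using (ℕ; _+_; _*_; _∸_; _^_; _≤_; _/_; zero; suc; z≤n; s≤s)
open import Data.Nat.Properties
  using (+-assoc; +-cancelˡ-≡; *-cancelʳ-≡; *-comm; *-assoc; *-identityʳ; *-distribʳ-+;
         ≤-refl; ≤-trans; +-mono-≤; n≤0⇒n≡0; m+n∸n≡m; m+n∸m≡n)
open import Data.Nat.DivMod using (_%_; m*n/n≡m; [m+kn]%n≡m%n; m≤n⇒m%n≡m)
open import Data.Nat.Divisibility using (_∣_; divides)
open import Data.Nat.Combinatorics using (_C_; nCk+nC[k+1]≡[n+1]C[k+1])
open import Data.Nat.Tactic.RingSolver using (solve-∀)
open import Data.Fin using (Fin; toℕ) renaming (_≤_ to _≤ᶠ_; zero to fzero; suc to fsuc)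
open import Data.Vec using (sum; tabulate)
open import Data.Vec.Properties using (tabulate-cong)
open import Data.Product using (_×_; ∃-syntax; ∃₂; _,_; proj₂)
open import Function using (_∘_)
open import Function.Bundles using (_⇔_; mk⇔; Equivalence)
open import Function.Construct.Composition using (_⇔-∘_)
open import Function.Construct.Symmetry using (⇔-sym)
open import Function.Related.TypeIsomorphisms using (¬-cong-⇔)
open import Data.Product.Function.NonDependent.Propositional using (_×-⇔_)
open import Relation.Nullary using (¬_; contradiction)
open import Relation.Binary.PropositionalEquality
  using (_≡_; _≢_; _≗_; refl; sym; trans; cong; cong₂; subst; subst₂; module ≡-Reasoning)

open Equivalence using (to; from)

data ℤ₃ : Set where
  0₃ 1₃ 2₃ : ℤ₃

suc₃ : ℤ₃ → ℤ₃
suc₃ 0₃ = 1₃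
suc₃ 1₃ = 2₃
suc₃ 2₃ = 0₃

infixl 6 _+₃_
infixl 7 _*₃_

_+₃_ : ℤ₃ → ℤ₃ → ℤ₃
0₃ +₃ y = y
1₃ +₃ y = suc₃ y
2₃ +₃ y = suc₃ (suc₃ y)

_*₃_ : ℤ₃ → ℤ₃ → ℤ₃
0₃ *₃ y = 0₃
1₃ *₃ y = y
2₃ *₃ y = y +₃ y

[_]₃ : ℕ → ℤ₃
[ zero  ]₃ = 0₃
[ suc n ]₃ = suc₃ [ n ]₃

suc₃-+₃ : ∀ x y → suc₃ (x +₃ y) ≡ suc₃ x +₃ y
suc₃-+₃ 0₃ y  = refl
suc₃-+₃ 1₃ y  = refl
suc₃-+₃ 2₃ 0₃ = refl
suc₃-+₃ 2₃ 1₃ = refl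
suc₃-+₃ 2₃ 2₃ = refl

+₃-identityʳ : ∀ x → x +₃ 0₃ ≡ x
+₃-identityʳ 0₃ = refl
+₃-identityʳ 1₃ = refl
+₃-identityʳ 2₃ = refl

x+₃x+₃x≡0₃ : ∀ x → x +₃ x +₃ x ≡ 0₃
x+₃x+₃x≡0₃ 0₃ = refl
x+₃x+₃x≡0₃ 1₃ = refl
x+₃x+₃x≡0₃ 2₃ = refl

x+₃[x+₃x]≡0₃ : ∀ x → x +₃ (x +₃ x) ≡ 0₃
x+₃[x+₃x]≡0₃ 0₃ = refl
x+₃[x+₃x]≡0₃ 1₃ = refl
x+₃[x+₃x]≡0₃ 2₃ = refl

*₃-zeroʳ : ∀ x → x *₃ 0₃ ≡ 0₃
*₃-zeroʳ 0₃ = refl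
*₃-zeroʳ 1₃ = refl
*₃-zeroʳ 2₃ = refl

*₃-≢0₃ : ∀ x y → x *₃ y ≢ 0₃ ⇔ (x ≢ 0₃ × y ≢ 0₃)
*₃-≢0₃ x y = mk⇔ (λ xy≢0 → (λ { refl → xy≢0 refl }) , (λ { refl → xy≢0 (*₃-zeroʳ x) }))
                 (λ (x≢0 , y≢0) → nonzero x y x≢0 y≢0)
  where
  nonzero : ∀ x y → x ≢ 0₃ → y ≢ 0₃ → x *₃ y ≢ 0₃
  nonzero 0₃ _  x≢0 _   = contradiction refl x≢0
  nonzero _  0₃ _   y≢0 = contradiction refl y≢0
  nonzero 1₃ 1₃ _   _   ()
  nonzero 1₃ 2₃ _   _   ()
  nonzero 2₃ 1₃ _   _   ()
  nonzero 2₃ 2₃ _   _   ()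

[+]₃ : ∀ m n → [ m + n ]₃ ≡ [ m ]₃ +₃ [ n ]₃
[+]₃ zero    n = refl
[+]₃ (suc m) n = trans (cong suc₃ ([+]₃ m n)) (suc₃-+₃ [ m ]₃ [ n ]₃)

[3+n]₃≡[n]₃ : ∀ n → [ 3 + n ]₃ ≡ [ n ]₃
[3+n]₃≡[n]₃ n with [ n ]₃
... | 0₃ = refl
... | 1₃ = refl
... | 2₃ = refl

3∣⇔[]₃≡0₃ : ∀ n → 3 ∣ n ⇔ [ n ]₃ ≡ 0₃
3∣⇔[]₃≡0₃ n = mk⇔ (λ { (divides q refl) → [q*3]₃≡0₃ q }) (divisible n)
  where
  [q*3]₃≡0₃ : ∀ q → [ q * 3 ]₃ ≡ 0₃
  [q*3]₃≡0₃ zero    = refl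
  [q*3]₃≡0₃ (suc q) = trans ([3+n]₃≡[n]₃ (q * 3)) ([q*3]₃≡0₃ q)

  divisible : ∀ n → [ n ]₃ ≡ 0₃ → 3 ∣ n
  divisible zero                _  = divides 0 refl
  divisible (suc (suc (suc n))) eq
    with divides q refl ← divisible n (trans (sym ([3+n]₃≡[n]₃ n)) eq) = divides (suc q) refl

[C]₃≢0₃⇔≤ : ∀ c s → c ≤ 2 → s ≤ 2 → [ c C s ]₃ ≢ 0₃ ⇔ s ≤ c
[C]₃≢0₃⇔≤ c s c≤2 s≤2 = mk⇔ (≤-of-nonzero c s c≤2 s≤2) (nonzero-of-≤ c s c≤2)
  where
  ≤-of-nonzero : ∀ c s → c ≤ 2 → s ≤ 2 → [ c C s ]₃ ≢ 0₃ → s ≤ c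
  ≤-of-nonzero 0 0 _ _ _ = z≤n
  ≤-of-nonzero 1 0 _ _ _ = z≤n
  ≤-of-nonzero 1 1 _ _ _ = ≤-refl
  ≤-of-nonzero 2 0 _ _ _ = z≤n
  ≤-of-nonzero 2 1 _ _ _ = s≤s z≤n
  ≤-of-nonzero 2 2 _ _ _ = ≤-refl
  ≤-of-nonzero 0 (suc _) _ _ h = contradiction refl h
  ≤-of-nonzero 1 2 _ _ h = contradiction refl h
  ≤-of-nonzero _ (suc (suc (suc _))) _ (s≤s (s≤s ())) _
  ≤-of-nonzero (suc (suc (suc _))) _ (s≤s (s≤s ())) _ _

  nonzero-of-≤ : ∀ c s → c ≤ 2 → s ≤ c → [ c C s ]₃ ≢ 0₃
  nonzero-of-≤ 0 0 _ _ ()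
  nonzero-of-≤ 1 0 _ _ ()
  nonzero-of-≤ 1 1 _ _ ()
  nonzero-of-≤ 2 0 _ _ ()
  nonzero-of-≤ 2 1 _ _ ()
  nonzero-of-≤ 2 2 _ _ ()
  nonzero-of-≤ 1 (suc (suc _)) _ (s≤s ())
  nonzero-of-≤ 2 (suc (suc (suc _))) _ (s≤s (s≤s ()))
  nonzero-of-≤ (suc (suc (suc _))) _ (s≤s (s≤s ())) _

pascal₃ : ∀ n k {x y} → [ n C k ]₃ ≡ x → [ n C suc k ]₃ ≡ y → [ suc n C suc k ]₃ ≡ x +₃ y
pascal₃ n k refl refl =
  trans (cong [_]₃ (sym (nCk+nC[k+1]≡[n+1]C[k+1] n k))) ([+]₃ (n C k) (n C suc k))

-- Each case peels one unit off the top with Pascal's rule; the recursion is on (a, r)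
-- lexicographically, since r + 3a decreases.
lucas₃ : ∀ r a s b → r ≤ 2 → s ≤ 2 →
         [ (r + a * 3) C (s + b * 3) ]₃ ≡ [ r C s ]₃ *₃ [ a C b ]₃
lucas₃ 0 zero    0 zero    _ _ = refl
lucas₃ 0 zero    0 (suc b) _ _ = refl
lucas₃ 0 zero    1 b       _ _ = refl
lucas₃ 0 zero    2 b       _ _ = refl
lucas₃ 0 (suc a) 0 zero    _ _ = refl
lucas₃ 0 (suc a) 0 (suc b) _ _ =
  trans (pascal₃ (2 + a * 3) (2 + b * 3)
                 (lucas₃ 2 a 2 b ≤-refl ≤-refl) (lucas₃ 2 a 0 (suc b) ≤-refl z≤n))
        (sym (pascal₃ a b refl refl))
lucas₃ 0 (suc a) 1 b       _ _ =
  trans (pascal₃ (2 + a * 3) (0 + b * 3)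
                 (lucas₃ 2 a 0 b ≤-refl z≤n) (lucas₃ 2 a 1 b ≤-refl (s≤s z≤n)))
        (x+₃[x+₃x]≡0₃ [ a C b ]₃)
lucas₃ 0 (suc a) 2 b       _ _ =
  trans (pascal₃ (2 + a * 3) (1 + b * 3)
                 (lucas₃ 2 a 1 b ≤-refl (s≤s z≤n)) (lucas₃ 2 a 2 b ≤-refl ≤-refl))
        (x+₃x+₃x≡0₃ [ a C b ]₃)
lucas₃ 1 a       0 zero    _ _ = refl
lucas₃ 1 a       0 (suc b) _ _ =
  pascal₃ (0 + a * 3) (2 + b * 3)
          (lucas₃ 0 a 2 b z≤n ≤-refl) (lucas₃ 0 a 0 (suc b) z≤n z≤n)
lucas₃ 1 a       1 b       _ _ =
  trans (pascal₃ (0 + a * 3) (0 + b * 3)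
                 (lucas₃ 0 a 0 b z≤n z≤n) (lucas₃ 0 a 1 b z≤n (s≤s z≤n)))
        (+₃-identityʳ [ a C b ]₃)
lucas₃ 1 a       2 b       _ _ =
  pascal₃ (0 + a * 3) (1 + b * 3)
          (lucas₃ 0 a 1 b z≤n (s≤s z≤n)) (lucas₃ 0 a 2 b z≤n ≤-refl)
lucas₃ 2 a       0 zero    _ _ = refl
lucas₃ 2 a       0 (suc b) _ _ =
  pascal₃ (1 + a * 3) (2 + b * 3)
          (lucas₃ 1 a 2 b (s≤s z≤n) ≤-refl) (lucas₃ 1 a 0 (suc b) (s≤s z≤n) z≤n)
lucas₃ 2 a       1 b       _ _ =
  pascal₃ (1 + a * 3) (0 + b * 3)
          (lucas₃ 1 a 0 b (s≤s z≤n) z≤n) (lucas₃ 1 a 1 b (s≤s z≤n) (s≤s z≤n))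
lucas₃ 2 a       2 b       _ _ =
  trans (pascal₃ (1 + a * 3) (1 + b * 3)
                 (lucas₃ 1 a 1 b (s≤s z≤n) (s≤s z≤n)) (lucas₃ 1 a 2 b (s≤s z≤n) ≤-refl))
        (+₃-identityʳ [ a C b ]₃)
lucas₃ (suc (suc (suc _))) _ _ _ (s≤s (s≤s ())) _
lucas₃ _ _ (suc (suc (suc _))) _ _ (s≤s (s≤s ()))

sum-tabulate-*ʳ : ∀ k (f : Fin k → ℕ) c → sum (tabulate (λ t → f t * c)) ≡ sum (tabulate f) * c
sum-tabulate-*ʳ zero    f c = refl
sum-tabulate-*ʳ (suc k) f c =
  trans (cong (f fzero * c +_) (sum-tabulate-*ʳ k (f ∘ fsuc) c))
        (sym (*-distribʳ-+ c (f fzero) (sum (tabulate (f ∘ fsuc)))))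

sum-tabulate-+ : ∀ k (f g : Fin k → ℕ) →
                 sum (tabulate (λ t → f t + g t)) ≡ sum (tabulate f) + sum (tabulate g)
sum-tabulate-+ zero    f g = refl
sum-tabulate-+ (suc k) f g =
  trans (cong (f fzero + g fzero +_) (sum-tabulate-+ k (f ∘ fsuc) (g ∘ fsuc)))
        (interchange (f fzero) (g fzero) (sum (tabulate (f ∘ fsuc))) (sum (tabulate (g ∘ fsuc))))
  where
  interchange : ∀ a b c d → a + b + (c + d) ≡ a + c + (b + d)
  interchange = solve-∀

base3-cong : ∀ k {d e : Fin k → ℕ} → d ≗ e → base3 k d ≡ base3 k e
base3-cong k d≗e = cong sum (tabulate-cong (λ t → cong (_* 3 ^ toℕ t) (d≗e t)))

base3-suc : ∀ k (d : Fin (suc k) → ℕ) → base3 (suc k) d ≡ d fzero + base3 k (d ∘ fsuc) * 3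
base3-suc k d = cong₂ _+_ (*-identityʳ (d fzero)) (begin
  sum (tabulate (λ t → d (fsuc t) * (3 * 3 ^ toℕ t)))
    ≡⟨ cong sum (tabulate-cong (λ t → *-shift (d (fsuc t)) (3 ^ toℕ t))) ⟩
  sum (tabulate (λ t → d (fsuc t) * 3 ^ toℕ t * 3))
    ≡⟨ sum-tabulate-*ʳ k (λ t → d (fsuc t) * 3 ^ toℕ t) 3 ⟩
  base3 k (d ∘ fsuc) * 3 ∎)
  where
  open ≡-Reasoning
  *-shift : ∀ x p → x * (3 * p) ≡ x * p * 3
  *-shift x p = trans (cong (x *_) (*-comm 3 p)) (sym (*-assoc x p 3))

base3-+ : ∀ k (d e : Fin k → ℕ) → base3 k (λ t → d t + e t) ≡ base3 k d + base3 k e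
base3-+ k d e = trans (cong sum (tabulate-cong (λ t → *-distribʳ-+ (3 ^ toℕ t) (d t) (e t))))
                      (sum-tabulate-+ k (λ t → d t * 3 ^ toℕ t) (λ t → e t * 3 ^ toℕ t))

≗-fsuc : ∀ {k} {d e : Fin (suc k) → ℕ} → d fzero ≡ e fzero → d ∘ fsuc ≗ e ∘ fsuc → d ≗ e
≗-fsuc head _    fzero    = head
≗-fsuc _    tail (fsuc t) = tail t

[r+x*3]%3≡r : ∀ {r} x → r ≤ 2 → (r + x * 3) % 3 ≡ r
[r+x*3]%3≡r {r} x r≤2 = trans ([m+kn]%n≡m%n r x 3) (m≤n⇒m%n≡m r≤2)

base3-injective : ∀ k (d e : Fin k → ℕ) → (∀ t → d t ≤ 2) → (∀ t → e t ≤ 2) →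
                  base3 k d ≡ base3 k e → d ≗ e
base3-injective zero    d e _   _   _  ()
base3-injective (suc k) d e d≤2 e≤2 eq = ≗-fsuc head≡ (base3-injective k (d ∘ fsuc) (e ∘ fsuc)
    (d≤2 ∘ fsuc) (e≤2 ∘ fsuc)
    (*-cancelʳ-≡ _ _ 3 (+-cancelˡ-≡ (d fzero) _ _ (trans eq′ (cong (_+ _) (sym head≡))))))
  where
  eq′ : d fzero + base3 k (d ∘ fsuc) * 3 ≡ e fzero + base3 k (e ∘ fsuc) * 3
  eq′ = trans (sym (base3-suc k d)) (trans eq (base3-suc k e))

  head≡ : d fzero ≡ e fzero
  head≡ = trans (sym ([r+x*3]%3≡r (base3 k (d ∘ fsuc)) (d≤2 fzero)))
                (trans (cong (_% 3) eq′) ([r+x*3]%3≡r (base3 k (e ∘ fsuc)) (e≤2 fzero)))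

Antitone : ∀ {k} → (Fin k → ℕ) → Set
Antitone d = ∀ s t → s ≤ᶠ t → d t ≤ d s

AntitoneBelow : ℕ → ∀ {k} → (Fin k → ℕ) → Set
AntitoneBelow c d = (∀ t → d t ≤ c) × Antitone d

antitoneBelow-suc : ∀ {c k} (d : Fin (suc k) → ℕ) →
                    AntitoneBelow c d ⇔ (d fzero ≤ c × AntitoneBelow (d fzero) (d ∘ fsuc))
antitoneBelow-suc {c} d = mk⇔
  (λ (bounded , anti) → bounded fzero , (λ t → anti fzero (fsuc t) z≤n)
                                      , (λ s t s≤t → anti (fsuc s) (fsuc t) (s≤s s≤t)))
  (λ (d₀≤c , bounded , anti) → bound d₀≤c bounded , antitone bounded anti)
  where
  bound : d fzero ≤ c → (∀ t → d (fsuc t) ≤ d fzero) → ∀ t → d t ≤ c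
  bound d₀≤c _       fzero    = d₀≤c
  bound d₀≤c bounded (fsuc t) = ≤-trans (bounded t) d₀≤c

  antitone : (∀ t → d (fsuc t) ≤ d fzero) → Antitone (d ∘ fsuc) → Antitone d
  antitone _       _    fzero    fzero    _         = ≤-refl
  antitone bounded _    fzero    (fsuc t) _         = bounded t
  antitone _       anti (fsuc s) (fsuc t) (s≤s s≤t) = anti s t s≤t

antitoneBelow-tail : ∀ {c c′ k} (d : Fin (suc k) → ℕ) →
                     AntitoneBelow c d → d fzero ≡ c′ → AntitoneBelow c′ (d ∘ fsuc)
antitoneBelow-tail d below refl = proj₂ (to (antitoneBelow-suc d) below)

antitone-+ : ∀ {k} {d e : Fin k → ℕ} → Antitone d → Antitone e → Antitone (λ t → d t + e t)
antitone-+ d↓ e↓ s t s≤t = +-mono-≤ (d↓ s t s≤t) (e↓ s t s≤t)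

antitone-head≡0 : ∀ {k} {d : Fin (suc k) → ℕ} → Antitone d → d fzero ≡ 0 → ∀ t → d t ≡ 0
antitone-head≡0 {d = d} anti d₀≡0 t = n≤0⇒n≡0 (subst (d t ≤_) d₀≡0 (anti fzero t z≤n))

-- The base-3 digits of c + 3(x + 3ᵏ) are c, d₀, …, d_{k−1}, 1 and those of x = base3 k d
-- are d₀, …, d_{k−1}.
shiftedBinomial : ℕ → (k : ℕ) → (Fin k → ℕ) → ℕ
shiftedBinomial c k d = (c + (base3 k d + 3 ^ k) * 3) C base3 k d

[shiftedBinomial-suc]₃ : ∀ c k (d : Fin (suc k) → ℕ) → c ≤ 2 → d fzero ≤ 2 →
  [ shiftedBinomial c (suc k) d ]₃ ≡ [ c C d fzero ]₃ *₃ [ shiftedBinomial (d fzero) k (d ∘ fsuc) ]₃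
[shiftedBinomial-suc]₃ c k d c≤2 d₀≤2 = begin
  [ (c + (base3 (suc k) d + 3 * 3 ^ k) * 3) C base3 (suc k) d ]₃
    ≡⟨ cong (λ x → [ (c + (x + 3 * 3 ^ k) * 3) C x ]₃) (base3-suc k d) ⟩
  [ (c + (d fzero + x * 3 + 3 * 3 ^ k) * 3) C (d fzero + x * 3) ]₃
    ≡⟨ cong (λ N → [ (c + N * 3) C (d fzero + x * 3) ]₃) (regroup (d fzero) x (3 ^ k)) ⟩
  [ (c + (d fzero + (x + 3 ^ k) * 3) * 3) C (d fzero + x * 3) ]₃
    ≡⟨ lucas₃ c (d fzero + (x + 3 ^ k) * 3) (d fzero) x c≤2 d₀≤2 ⟩
  [ c C d fzero ]₃ *₃ [ shiftedBinomial (d fzero) k (d ∘ fsuc) ]₃ ∎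
  where
  open ≡-Reasoning
  x : ℕ
  x = base3 k (d ∘ fsuc)
  regroup : ∀ a y p → a + y * 3 + 3 * p ≡ a + (y + p) * 3
  regroup = solve-∀

[shiftedBinomial]₃≢0₃⇔antitoneBelow : ∀ c k (d : Fin k → ℕ) → c ≤ 2 → (∀ t → d t ≤ 2) →
                                      [ shiftedBinomial c k d ]₃ ≢ 0₃ ⇔ AntitoneBelow c d
[shiftedBinomial]₃≢0₃⇔antitoneBelow c zero d _ _ = mk⇔ (λ _ → (λ ()) , (λ ())) (λ _ ())
[shiftedBinomial]₃≢0₃⇔antitoneBelow c (suc k) d c≤2 d≤2
  rewrite [shiftedBinomial-suc]₃ c k d c≤2 (d≤2 fzero) =
    ⇔-sym (antitoneBelow-suc d)
    ⇔-∘ (([C]₃≢0₃⇔≤ c (d fzero) c≤2 (d≤2 fzero)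
          ×-⇔ [shiftedBinomial]₃≢0₃⇔antitoneBelow (d fzero) k (d ∘ fsuc) (d≤2 fzero) (d≤2 ∘ fsuc))
    ⇔-∘ *₃-≢0₃ [ c C d fzero ]₃ [ shiftedBinomial (d fzero) k (d ∘ fsuc) ]₃)

repunit : ℕ → ℕ
repunit zero    = 0
repunit (suc j) = 1 + repunit j * 3

3^j≡1+repunit[j]*2 : ∀ j → 3 ^ j ≡ 1 + repunit j * 2
3^j≡1+repunit[j]*2 zero    = refl
3^j≡1+repunit[j]*2 (suc j) = trans (cong (3 *_) (3^j≡1+repunit[j]*2 j)) (triple (repunit j))
  where
  triple : ∀ r → 3 * (1 + r * 2) ≡ 1 + (1 + r * 3) * 2
  triple = solve-∀

[3^j∸1]/2≡repunit : ∀ j → (3 ^ j ∸ 1) / 2 ≡ repunit j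
[3^j∸1]/2≡repunit j =
  trans (cong (λ p → (p ∸ 1) / 2) (3^j≡1+repunit[j]*2 j)) (m*n/n≡m (repunit j) 2)

[3^j+1]/2≡1+repunit : ∀ j → (3 ^ j + 1) / 2 ≡ 1 + repunit j
[3^j+1]/2≡1+repunit j =
  trans (cong (λ p → (p + 1) / 2) (3^j≡1+repunit[j]*2 j))
        (trans (cong (_/ 2) (halve (repunit j))) (m*n/n≡m (1 + repunit j) 2))
  where
  halve : ∀ r → 1 + r * 2 + 1 ≡ (1 + r) * 2
  halve = solve-∀

ones : ℕ → ∀ {m} → Fin m → ℕ
ones zero    t        = 0
ones (suc j) fzero    = 1
ones (suc j) (fsuc t) = ones j t

ones≤1 : ∀ j {m} (t : Fin m) → ones j t ≤ 1
ones≤1 zero    t        = z≤n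
ones≤1 (suc j) fzero    = ≤-refl
ones≤1 (suc j) (fsuc t) = ones≤1 j t

ones-antitone : ∀ j {m} → Antitone (ones j {m})
ones-antitone zero    s        t        _         = z≤n
ones-antitone (suc j) fzero    fzero    _         = ≤-refl
ones-antitone (suc j) fzero    (fsuc t) _         = ones≤1 j t
ones-antitone (suc j) (fsuc s) (fsuc t) (s≤s s≤t) = ones-antitone j s t s≤t

base3-ones : ∀ m j → j ≤ m → base3 m (ones j) ≡ repunit j
base3-ones zero    zero    _       = refl
base3-ones (suc m) zero    _       = trans (base3-suc m (ones 0)) (cong (_* 3) (base3-ones m 0 z≤n))
base3-ones (suc m) (suc j) (s≤s j≤m) =
  trans (base3-suc m (ones (suc j))) (cong (λ x → 1 + x * 3) (base3-ones m j j≤m))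

base3-ones+ones : ∀ m j k → j ≤ k → k ≤ m →
                  base3 m (λ t → ones j t + ones k t) ≡ repunit j + repunit k
base3-ones+ones m j k j≤k k≤m = trans (base3-+ m (ones j) (ones k))
  (cong₂ _+_ (base3-ones m j (≤-trans j≤k k≤m)) (base3-ones m k k≤m))

antitoneBelow1⇒≗ones : ∀ {m} (d : Fin m → ℕ) → AntitoneBelow 1 d → ∃[ k ] k ≤ m × d ≗ ones k
antitoneBelow1⇒≗ones {zero}  d _ = 0 , z≤n , λ ()
antitoneBelow1⇒≗ones {suc m} d below@(bounded , anti) with d fzero in d₀ | bounded fzero
... | 0 | _ = 0 , z≤n , antitone-head≡0 anti d₀
... | 1 | _ with k , k≤m , tail≗ ← antitoneBelow1⇒≗ones (d ∘ fsuc) (antitoneBelow-tail d below d₀)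
  = suc k , s≤s k≤m , ≗-fsuc d₀ tail≗
... | suc (suc _) | s≤s ()

antitoneBelow2⇒≗ones+ones : ∀ {m} (d : Fin m → ℕ) → AntitoneBelow 2 d →
                  ∃₂ λ j k → j ≤ k × k ≤ m × d ≗ (λ t → ones j t + ones k t)
antitoneBelow2⇒≗ones+ones {zero}  d _ = 0 , 0 , z≤n , z≤n , λ ()
antitoneBelow2⇒≗ones+ones {suc m} d below@(bounded , anti) with d fzero in d₀ | bounded fzero
... | 0 | _ = 0 , 0 , z≤n , z≤n , antitone-head≡0 anti d₀
... | 1 | _ with k , k≤m , tail≗ ← antitoneBelow1⇒≗ones (d ∘ fsuc) (antitoneBelow-tail d below d₀)
  = 0 , suc k , z≤n , s≤s k≤m , ≗-fsuc d₀ tail≗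
... | 2 | _
  with j , k , j≤k , k≤m , tail≗
         ← antitoneBelow2⇒≗ones+ones (d ∘ fsuc) (antitoneBelow-tail d below d₀)
  = suc j , suc k , s≤s j≤k , s≤s k≤m , ≗-fsuc d₀ tail≗
... | suc (suc (suc _)) | s≤s (s≤s ())

antitone⇔repunitSum : ∀ m (d : Fin m → ℕ) → (∀ t → d t ≤ 2) →
  Antitone d ⇔ ∃₂ λ j k → j ≤ k × k ≤ m × base3 m d ≡ repunit j + repunit k
antitone⇔repunitSum m d d≤2 = mk⇔ toRepunits fromRepunits
  where
  toRepunits : Antitone d → ∃₂ λ j k → j ≤ k × k ≤ m × base3 m d ≡ repunit j + repunit k
  toRepunits anti with j , k , j≤k , k≤m , d≗ ← antitoneBelow2⇒≗ones+ones d (d≤2 , anti)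
    = j , k , j≤k , k≤m , trans (base3-cong m d≗) (base3-ones+ones m j k j≤k k≤m)

  fromRepunits : (∃₂ λ j k → j ≤ k × k ≤ m × base3 m d ≡ repunit j + repunit k) → Antitone d
  fromRepunits (j , k , j≤k , k≤m , eq) s t s≤t =
    subst₂ _≤_ (sym (d≗ t)) (sym (d≗ s)) (antitone-+ (ones-antitone j) (ones-antitone k) s t s≤t)
    where
    d≗ : d ≗ (λ t → ones j t + ones k t)
    d≗ = base3-injective m d _ d≤2 (λ t → +-mono-≤ (ones≤1 j t) (ones≤1 k t))
           (trans eq (sym (base3-ones+ones m j k j≤k k≤m)))

binomial-top : ∀ n x → 3 * ((3 ^ suc n + 1) / 2 + x) ∸ (3 ^ suc n ∸ 1) / 2 ≡ 2 + (x + 3 ^ n) * 3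
binomial-top n x = begin
  3 * ((3 ^ suc n + 1) / 2 + x) ∸ (3 ^ suc n ∸ 1) / 2
    ≡⟨ cong₂ (λ h r → 3 * (h + x) ∸ r) ([3^j+1]/2≡1+repunit (suc n)) ([3^j∸1]/2≡repunit (suc n)) ⟩
  3 * (2 + r * 3 + x) ∸ (1 + r * 3)
    ≡⟨ cong (_∸ (1 + r * 3)) (expand r x) ⟩
  2 + (x + (1 + r * 2)) * 3 + (1 + r * 3) ∸ (1 + r * 3)
    ≡⟨ m+n∸n≡m _ (1 + r * 3) ⟩
  2 + (x + (1 + r * 2)) * 3
    ≡⟨ cong (λ p → 2 + (x + p) * 3) (sym (3^j≡1+repunit[j]*2 n)) ⟩
  2 + (x + 3 ^ n) * 3 ∎
  where
  open ≡-Reasoning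
  r : ℕ
  r = repunit n
  expand : ∀ r x → 3 * (2 + r * 3 + x) ≡ 2 + (x + (1 + r * 2)) * 3 + (1 + r * 3)
  expand = solve-∀

repunitSum⇔halves : ∀ m h x →
  (∃₂ λ j k → j ≤ k × k ≤ m × x ≡ repunit j + repunit k)
    ⇔ (∃₂ λ j k → j ≤ k × k ≤ m × h + x ≡ h + (3 ^ j ∸ 1) / 2 + (3 ^ k ∸ 1) / 2)
repunitSum⇔halves m h x = mk⇔
  (λ (j , k , j≤k , k≤m , eq) → j , k , j≤k , k≤m , to (shifted j k) eq)
  (λ (j , k , j≤k , k≤m , eq) → j , k , j≤k , k≤m , from (shifted j k) eq)
  where
  shifted : ∀ j k → x ≡ repunit j + repunit k ⇔ h + x ≡ h + (3 ^ j ∸ 1) / 2 + (3 ^ k ∸ 1) / 2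
  shifted j k rewrite [3^j∸1]/2≡repunit j | [3^j∸1]/2≡repunit k = mk⇔
    (λ eq → trans (cong (h +_) eq) (sym (+-assoc h (repunit j) (repunit k))))
    (λ eq → +-cancelˡ-≡ h _ _ (trans eq (+-assoc h (repunit j) (repunit k))))

theorem4 : (n : ℕ) → 1 ≤ n → (i : ℕ)
    → (3 ^ n + 1) / 2 ≤ i → i ≤ (5 * 3 ^ n ∸ 3) / 6
    → (d : Fin (n ∸ 1) → ℕ) → (∀ t → d t ≤ 2)
    → i ≡ (3 ^ n + 1) / 2 + base3 (n ∸ 1) d
    → ((¬ (3 ∣ ((3 * i ∸ (3 ^ n ∸ 1) / 2) C (i ∸ (3 ^ n + 1) / 2))))
        ⇔ (∀ (s t : Fin (n ∸ 1)) → s ≤ᶠ t → d t ≤ d s))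
      × ((∀ (s t : Fin (n ∸ 1)) → s ≤ᶠ t → d t ≤ d s)
        ⇔ ∃₂ λ j k → j ≤ k × k ≤ n ∸ 1
            × i ≡ (3 ^ n + 1) / 2 + (3 ^ j ∸ 1) / 2 + (3 ^ k ∸ 1) / 2)
theorem4 (suc n) _ _ _ _ d d≤2 refl
  rewrite binomial-top n (base3 n d) | m+n∸m≡n ((3 ^ suc n + 1) / 2) (base3 n d) =
    belowTwo ⇔-∘ ([shiftedBinomial]₃≢0₃⇔antitoneBelow 2 n d ≤-refl d≤2 ⇔-∘ ¬-cong-⇔ (3∣⇔[]₃≡0₃ _))
  , repunitSum⇔halves n ((3 ^ suc n + 1) / 2) (base3 n d) ⇔-∘ antitone⇔repunitSum n d d≤2
  where
  belowTwo : AntitoneBelow 2 d ⇔ Antitone d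
  belowTwo = mk⇔ proj₂ (d≤2 ,_)
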